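{- Let $G$ and $G'$ be graphs with $V(G')=V(G)$. Let $T\subseteq\mathcal{T}(G)$, let $P'$ be a triangle packing in $G'$, and let $\Pi'$ be a nonempty subset of $\mathfrak{S}(G)$. Then $$\nu(G)\ \ge\ \frac{1}{|\Pi'|}\sum_{t\in T}\sum_{t'\in P'}\bigl|\{\pi\in\Pi' : t=\pi(t')\}\bigr|,$$ where $\pi(t')$ denotes the triangle on the vertex set $\{\pi(x): x\in V(t')\}$.
   Context: A triangle packing of a graph is a set of pairwise edge-disjoint triangles of the graph; $\nu(G)$ is the maximum size of a triangle packing of $G$. $\mathcal{T}(G)$ is the set of all triangles of $G$, and $\mathfrak{S}(G)$ is the set of all permutations of $V(G)$. -}

module Defs where

open import Data.Nat using (ℕ; _≤_; _*_)
open import Data.Bool using (Bool)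
import Data.Bool.Properties as BoolP
open import Data.Fin using (Fin)
open import Data.Fin.Subset using (Subset; _∈_; ∣_∣)
open import Data.Fin.Permutation using (Permutation′; _⟨$⟩ʳ_; _⟨$⟩ˡ_; _≈_)
open import Data.Vec using (lookup; tabulate)
import Data.Vec.Properties as VecP
open import Data.List using (List; []; length; filter; map)
open import Data.Nat.ListAction using (sum)
open import Data.List.Relation.Unary.All using (All)
open import Data.List.Relation.Unary.AllPairs using (AllPairs)
open import Data.Product using (_×_; ∃)
open import Data.Empty using (⊥)
open import Relation.Nullary using (¬_)
open import Relation.Binary.PropositionalEquality using (_≡_; _≢_)
open import Relation.Binary.Definitions using (DecidableEquality)

record Graph (n : ℕ) : Set₁ where
  field
    Adj    : Fin n → Fin n → Set
    sym    : ∀ {u v} → Adj u v → Adj v u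
    irrefl : ∀ {u} → ¬ Adj u u
open Graph public

-- A triangle is represented by its vertex set (a subset of size 3).
Triangle : ℕ → Set
Triangle n = Subset n

IsTriangle : ∀ {n} → Graph n → Triangle n → Set
IsTriangle G t = (∣ t ∣ ≡ 3) × (∀ u v → u ∈ t → v ∈ t → u ≢ v → Adj G u v)

EdgeDisjoint : ∀ {n} → Triangle n → Triangle n → Set
EdgeDisjoint t s = ∀ u v → u ≢ v → u ∈ t → v ∈ t → u ∈ s → v ∈ s → ⊥

-- A triangle packing of G (given as a list; pairwise edge-disjointness
-- forces the entries to be distinct).
IsPacking : ∀ {n} → Graph n → List (Triangle n) → Set
IsPacking G P = All (IsTriangle G) P × AllPairs EdgeDisjoint P

IsNu : ∀ {n} → Graph n → ℕ → Set
IsNu G k = (∃ λ P → IsPacking G P × length P ≡ k)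
         × (∀ P → IsPacking G P → length P ≤ k)

-- π(t) : the triangle on vertex set {π x : x ∈ t}.
image : ∀ {n} → Permutation′ n → Triangle n → Triangle n
image π t = tabulate (λ y → lookup t (π ⟨$⟩ˡ y))

_≟ₜ_ : ∀ {n} → DecidableEquality (Triangle n)
_≟ₜ_ = VecP.≡-dec BoolP._≟_

count : ∀ {n} → List (Permutation′ n) → Triangle n → Triangle n → ℕ
count Π t t' = length (filter (λ π → t ≟ₜ image π t') Π)

doubleSum : ∀ {n} → List (Permutation′ n) → List (Triangle n) → List (Triangle n) → ℕ
doubleSum Π T P' = sum (map (λ t → sum (map (λ t' → count Π t t') P')) T)

DistinctPerms : ∀ {n} → List (Permutation′ n) → Set
DistinctPerms Π = AllPairs (λ π σ → ¬ (π ≈ σ)) Π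

-- For a single permutation π, the triangles π(t') with t' ∈ P' and π(t') ∈ T
-- lie in G and are pairwise edge-disjoint (π is a bijection), so they form a
-- packing of G; as T has no repetitions, π contributes at most ν to the double
-- sum. Summing over Π' gives |Π'| · ν.
module Submission where

open import Defs hiding (sym)
open import Data.Nat using (ℕ; suc; _+_; _*_; _≤_; _<_; z≤n; s≤s)
open import Data.Nat.Properties using (≤-reflexive; +-mono-≤; ≮⇒≥; +-commutativeSemigroup; module ≤-Reasoning)
open import Algebra.Properties.CommutativeSemigroup +-commutativeSemigroup
  using () renaming (interchange to +-interchange)
open import Data.Nat.ListAction using (sum)
open import Data.List using (List; []; _∷_; [_]; _++_; length; map; filter)
open import Data.List.Properties using (map-cong; length-map; length-++; filter-++; filter-none)
open import Data.List.Relation.Unary.All as All using (All)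
import Data.List.Relation.Unary.All.Properties as All
open import Data.List.Relation.Unary.AllPairs as AllPairs using (AllPairs; _∷_)
import Data.List.Relation.Unary.AllPairs.Properties as AllPairs
open import Data.List.Relation.Unary.Any using (here; there)
open import Data.List.Relation.Unary.Unique.Propositional using (Unique)
open import Data.List.Membership.Propositional using (_∈_)
import Data.List.Membership.DecPropositional as DecMembership
open import Data.Fin.Subset using () renaming (_∈_ to _∈ₛ_)
open import Data.Fin.Permutation using (Permutation′; _⟨$⟩ˡ_; _⟨$⟩ʳ_; inverseʳ)
open import Data.Vec.Properties using (lookup∘tabulate; []=⇒lookup; lookup⇒[]=)
open import Data.Product using (_,_)
open import Function using (_∘_)
open import Relation.Nullary using (yes; no)
open import Relation.Unary using (Pred; Decidable)
open import Relation.Binary.Definitions using (DecidableEquality)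
open import Relation.Binary.PropositionalEquality
  using (_≡_; _≢_; refl; sym; trans; cong; ≢-sym)

private variable
  A B : Set

sum-map-zero : ∀ {f : A → ℕ} → (∀ x → f x ≡ 0) → ∀ xs → sum (map f xs) ≡ 0
sum-map-zero f≡0 []       = refl
sum-map-zero f≡0 (x ∷ xs) rewrite f≡0 x = sum-map-zero f≡0 xs

sum-map-+ : ∀ (f g : A → ℕ) xs →
            sum (map (λ x → f x + g x) xs) ≡ sum (map f xs) + sum (map g xs)
sum-map-+ f g []       = refl
sum-map-+ f g (x ∷ xs) = trans (cong (f x + g x +_) (sum-map-+ f g xs))
                               (+-interchange (f x) (g x) _ _)

sum-map-swap : ∀ (f : A → B → ℕ) xs ys →
               sum (map (λ x → sum (map (f x) ys)) xs) ≡ sum (map (λ y → sum (map (λ x → f x y) xs)) ys)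
sum-map-swap f []       ys = sym (sum-map-zero (λ _ → refl) ys)
sum-map-swap f (x ∷ xs) ys = trans (cong (sum (map (f x) ys) +_) (sum-map-swap f xs ys))
                                   (sym (sum-map-+ (f x) _ ys))

sum-map-≤-length-filter : ∀ {p} {P : Pred A p} (P? : Decidable P) {f : A → ℕ} →
                          (∀ x → f x ≤ 1) → (∀ x → 0 < f x → P x) →
                          ∀ xs → sum (map f xs) ≤ length (filter P? xs)
sum-map-≤-length-filter P? f≤1 f>0⇒P []       = z≤n
sum-map-≤-length-filter P? f≤1 f>0⇒P (x ∷ xs) with P? x
... | yes _  = +-mono-≤ (f≤1 x) (sum-map-≤-length-filter P? f≤1 f>0⇒P xs)
... | no ¬Px = +-mono-≤ (≮⇒≥ (¬Px ∘ f>0⇒P x)) (sum-map-≤-length-filter P? f≤1 f>0⇒P xs)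

module Occurrences (_≟_ : DecidableEquality A) where

  occurrences : A → List A → ℕ
  occurrences x xs = length (filter (_≟ x) xs)

  Unique⇒occurrences≤1 : ∀ {x xs} → Unique xs → occurrences x xs ≤ 1
  Unique⇒occurrences≤1 {x} {[]}     _ = z≤n
  Unique⇒occurrences≤1 {x} {y ∷ ys} (y∉ys ∷ unique) with y ≟ x
  ... | yes refl = s≤s (≤-reflexive (cong length (filter-none (_≟ x) (All.map ≢-sym y∉ys))))
  ... | no _     = Unique⇒occurrences≤1 unique

  occurrences>0⇒∈ : ∀ {x xs} → 0 < occurrences x xs → x ∈ xs
  occurrences>0⇒∈ {x} {y ∷ ys} pos with y ≟ x
  ... | yes refl = here refl
  ... | no _     = there (occurrences>0⇒∈ pos)

module _ {n : ℕ} where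

  open Occurrences (_≟ₜ_ {n})
  open DecMembership (_≟ₜ_ {n}) using (_∈?_)

  image-∈⁻ : ∀ (π : Permutation′ n) t {u} → u ∈ₛ image π t → π ⟨$⟩ˡ u ∈ₛ t
  image-∈⁻ π t {u} u∈πt = lookup⇒[]= _ t (trans (sym (lookup∘tabulate _ u)) ([]=⇒lookup u∈πt))

  image-EdgeDisjoint : ∀ (π : Permutation′ n) {t s} →
                       EdgeDisjoint t s → EdgeDisjoint (image π t) (image π s)
  image-EdgeDisjoint π {t} {s} t#s u v u≢v u∈πt v∈πt u∈πs v∈πs =
    t#s (π ⟨$⟩ˡ u) (π ⟨$⟩ˡ v) (u≢v ∘ ⟨$⟩ˡ-injective)
        (image-∈⁻ π t u∈πt) (image-∈⁻ π t v∈πt) (image-∈⁻ π s u∈πs) (image-∈⁻ π s v∈πs)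
    where
    ⟨$⟩ˡ-injective : π ⟨$⟩ˡ u ≡ π ⟨$⟩ˡ v → u ≡ v
    ⟨$⟩ˡ-injective eq = trans (sym (inverseʳ π)) (trans (cong (π ⟨$⟩ʳ_) eq) (inverseʳ π))

  image-packing : ∀ {G : Graph n} π {T P'} → All (IsTriangle G) T → AllPairs EdgeDisjoint P' →
                  IsPacking G (map (image π) (filter (λ t' → image π t' ∈? T) P'))
  image-packing π {T} {P'} T⊆𝒯G P'-disjoint =
      All.map⁺ (All.map (All.lookup T⊆𝒯G) (All.all-filter (λ t' → image π t' ∈? T) P'))
    , AllPairs.map⁺ (AllPairs.map (image-EdgeDisjoint π)
                                  (AllPairs.filter⁺ (λ t' → image π t' ∈? T) P'-disjoint))

  sum-count-singleton : ∀ (π : Permutation′ n) T t' →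
                        sum (map (λ t → count [ π ] t t') T) ≡ occurrences (image π t') T
  sum-count-singleton π []      t' = refl
  sum-count-singleton π (t ∷ T) t' with t ≟ₜ image π t'
  ... | yes _ = cong suc (sum-count-singleton π T t')
  ... | no _  = sum-count-singleton π T t'

  count-++ : ∀ (Π₁ Π₂ : List (Permutation′ n)) t t' →
             count (Π₁ ++ Π₂) t t' ≡ count Π₁ t t' + count Π₂ t t'
  count-++ Π₁ Π₂ t t' = trans (cong length (filter-++ (λ π → t ≟ₜ image π t') Π₁ Π₂))
                              (length-++ (filter _ Π₁))

  doubleSum-[] : ∀ (T P' : List (Triangle n)) → doubleSum [] T P' ≡ 0
  doubleSum-[] T P' = sum-map-zero (λ _ → sum-map-zero (λ _ → refl) P') T

  doubleSum-++ : ∀ (Π₁ Π₂ : List (Permutation′ n)) T P' →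
                 doubleSum (Π₁ ++ Π₂) T P' ≡ doubleSum Π₁ T P' + doubleSum Π₂ T P'
  doubleSum-++ Π₁ Π₂ T P' = trans (cong sum (map-cong inner-++ T)) (sum-map-+ _ _ T)
    where
    inner-++ : ∀ t → sum (map (count (Π₁ ++ Π₂) t) P')
                   ≡ sum (map (count Π₁ t) P') + sum (map (count Π₂ t) P')
    inner-++ t = trans (cong sum (map-cong (count-++ Π₁ Π₂ t) P')) (sum-map-+ _ _ P')

  doubleSum-[_]≤ν : ∀ (π : Permutation′ n) {G : Graph n} {T P' ν} →
                    Unique T → All (IsTriangle G) T → AllPairs EdgeDisjoint P' →
                    (∀ P → IsPacking G P → length P ≤ ν) → doubleSum [ π ] T P' ≤ ν
  doubleSum-[ π ]≤ν {G} {T} {P'} {ν} T-unique T⊆𝒯G P'-disjoint ν-max = begin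
    doubleSum [ π ] T P'
      ≡⟨ sum-map-swap (count [ π ]) T P' ⟩
    sum (map (λ t' → sum (map (λ t → count [ π ] t t') T)) P')
      ≡⟨ cong sum (map-cong (sum-count-singleton π T) P') ⟩
    sum (map (λ t' → occurrences (image π t') T) P')
      ≤⟨ sum-map-≤-length-filter (λ t' → image π t' ∈? T)
           (λ _ → Unique⇒occurrences≤1 T-unique) (λ _ → occurrences>0⇒∈) P' ⟩
    length hits
      ≡⟨ sym (length-map (image π) hits) ⟩
    length (map (image π) hits)
      ≤⟨ ν-max _ (image-packing {G} π T⊆𝒯G P'-disjoint) ⟩
    ν ∎
    where
    open ≤-Reasoning
    hits : List (Triangle n)
    hits = filter (λ t' → image π t' ∈? T) P'

  doubleSum≤length*ν : ∀ (T P' : List (Triangle n)) {ν} → (∀ π → doubleSum [ π ] T P' ≤ ν) →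
                       ∀ Π → doubleSum Π T P' ≤ length Π * ν
  doubleSum≤length*ν T P' bound []          = ≤-reflexive (doubleSum-[] T P')
  doubleSum≤length*ν T P' {ν} bound (π ∷ Π) = begin
    doubleSum (π ∷ Π) T P'                  ≡⟨ doubleSum-++ [ π ] Π T P' ⟩
    doubleSum [ π ] T P' + doubleSum Π T P' ≤⟨ +-mono-≤ (bound π) (doubleSum≤length*ν T P' bound Π) ⟩
    ν + length Π * ν                        ∎
    where open ≤-Reasoning

lemma2 : ∀ {n} (G G' : Graph n) (T : List (Triangle n)) → Unique T → All (IsTriangle G) T
       → (P' : List (Triangle n)) → IsPacking G' P'
       → (Π' : List (Permutation′ n)) → DistinctPerms Π' → Π' ≢ []
       → (ν : ℕ) → IsNu G ν
       → doubleSum Π' T P' ≤ length Π' * ν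
lemma2 G G' T T-unique T⊆𝒯G P' (_ , P'-disjoint) Π' _ _ ν (_ , ν-max) =
  doubleSum≤length*ν T P' (λ π → doubleSum-[ π ]≤ν {G} T-unique T⊆𝒯G P'-disjoint ν-max) Π'
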